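{- Let $n$ be a positive integer and let $p=8n$. Consider the subtraction game on a single pile in which a move consists of removing $s$ stones from the pile, where $s\in\{2,4n,4n+2\}$ and at least $s$ stones are present; a player unable to move loses. For $x\in\mathbb{Z}_{\ge 0}$ let $\mathcal{G}(x)$ be the Grundy number of the position with $x$ stones. Then for all $k,m\in\mathbb{Z}_{\ge 0}$ with $m\le n-1$: (i) $\mathcal{G}(pk+4m+t)=0$ for $t=0,1$; (ii) $\mathcal{G}(pk+4m+t)=1$ for $t=2,3$; (iii) $\mathcal{G}(pk+4n+4m+t)=2$ for $t=0,1$; (iv) $\mathcal{G}(pk+4n+4m+t)=3$ for $t=2,3$.
   Context: The minimum excluded value $\operatorname{mex}(S)$ of a set $S$ of nonnegative integers is the least nonnegative integer not in $S$. The Grundy number is defined recursively by $\mathcal{G}(x)=\operatorname{mex}\{\mathcal{G}(x-s): s\in\{2,4n,4n+2\},\ x-s\ge 0\}$ (so $\mathcal{G}(x)=0$ when no move is available). -}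

module Defs where

open import Data.Nat using (ℕ; zero; suc; _+_; _*_; _∸_; _≤ᵇ_)
open import Data.Nat.Properties using (_≟_)
open import Data.Bool using (Bool; true; false; if_then_else_; _∧_)
open import Data.List using (List; []; _∷_; length)
open import Data.Bool.ListAction using (any)
open import Relation.Nullary.Decidable using (⌊_⌋)

elem : ℕ → List ℕ → Bool
elem k l = any (λ y → ⌊ k ≟ y ⌋) l

-- mex of a finite list: the least k not in the list.
-- The search from k upward with fuel (length l + 1) always suffices,
-- since among 0 .. length l some value is missing.
mexFrom : ℕ → ℕ → List ℕ → ℕ
mexFrom zero k l = k
mexFrom (suc fuel) k l = if elem k l then mexFrom fuel (suc k) l else k

mex : List ℕ → ℕ
mex l = mexFrom (suc (length l)) 0 l

moves : ℕ → List ℕ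
moves n = 2 ∷ 4 * n ∷ 4 * n + 2 ∷ []

-- lookup of G(y) in a table  [G(x-1), G(x-2), ..., G(0)]  (reversed history),
-- where y = x ∸ s with 1 ≤ s ≤ x, i.e. index s-1 in the table.
index : List ℕ → ℕ → ℕ
index [] _ = 0
index (v ∷ vs) zero = v
index (v ∷ vs) (suc i) = index vs i


optVals : List ℕ → ℕ → List ℕ → List ℕ
optVals h x [] = []
optVals h x (s ∷ ss) =
  if (1 ≤ᵇ s) ∧ (s ≤ᵇ x) then index h (s ∸ 1) ∷ optVals h x ss else optVals h x ss
-- (s ≥ 1 always holds when n ≥ 1; the guard just keeps 'index' meaningful)

history : ℕ → ℕ → List ℕ
history n zero = []
history n (suc x) = mex (optVals (history n x) x (moves n)) ∷ history n x

grundy : ℕ → ℕ → ℕ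
grundy n x = mex (optVals (history n x) x (moves n))

module Submission where

-- Write a pile as x = 8nk + 4nh + 4m + 2b + c with h, b, c ∈ {0, 1} and m < n; the claim is
-- G(x) = 2h + b. Removing 4n flips h, removing 2 flips b (and also h when it borrows from
-- m = 0), and removing 4n + 2 is removing 2 and then 4n. So the three moves change (h, b) by
-- the three distinct nonzero vectors of (ℤ/2)²: the options of x carry labels other than 2h + b,
-- all three of them except near the bottom (k = h = 0), where every illegal move would have led
-- to a larger label. Hence the mex is 2h + b, by strong induction on x.

open import Defs
open import Data.Bool using (Bool; true; false; if_then_else_)
open import Data.Bool.Properties using (T-≡)
open import Data.Fin using (Fin; zero; suc; toℕ; fromℕ; fromℕ<; inject₁)
open import Data.Fin.Properties using (toℕ<n; toℕ-fromℕ; toℕ-inject₁; toℕ-fromℕ<)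
open import Data.List using (List; []; _∷_; _?∷_)
open import Data.Maybe as Maybe using (Maybe; just; nothing; _>>=_)
open import Data.Maybe.Relation.Unary.All as AllMaybe
  using (just; nothing) renaming (All to AllMaybe)
open import Data.Nat using (ℕ; zero; suc; _+_; _*_; _≤_; _<_; _∸_; z≤n; s≤s; z<s)
open import Data.Nat.Induction using (<-wellFounded)
open import Data.Nat.Properties
open import Algebra.Properties.CommutativeSemigroup +-commutativeSemigroup using (x∙yz≈y∙xz)
open import Data.Nat.Tactic.RingSolver using (solve-∀)
open import Data.Product using (_×_; _,_)
open import Function.Bundles using (Equivalence)
open import Function.Base using (_on_)
open import Induction.WellFounded using (WfRec; module All)
open import Relation.Nullary.Decidable using (dec-false)
open import Relation.Binary.Construct.On as On using ()
open import Relation.Binary.PropositionalEquality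
  using (_≡_; refl; sym; trans; cong; subst; module ≡-Reasoning)

module _ (n : ℕ) where

  index-history : ∀ y i → index (history n (suc i + y)) i ≡ grundy n y
  index-history y zero    = refl
  index-history y (suc i) = index-history y i

  optVals-legal : ∀ {x y s} ss → suc s + y ≡ x →
    optVals (history n x) x (suc s ∷ ss) ≡ grundy n y ∷ optVals (history n x) x ss
  optVals-legal {y = y} {s} ss refl
    rewrite Equivalence.to T-≡ (≤⇒≤ᵇ (m≤m+n (suc s) y)) =
    cong (_∷ optVals (history n (suc s + y)) (suc s + y) ss) (index-history y s)

optVals-illegal : ∀ {h x s} ss → x < suc s →
  optVals h x (suc s ∷ ss) ≡ optVals h x ss
optVals-illegal {x = x} {s} ss x<s rewrite dec-false (suc s ≤? x) (<⇒≱ x<s) = refl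

bit : ℕ → Bool → ℕ
bit w b = if b then w else 0

bit≤ : ∀ w b → bit w b ≤ w
bit≤ w false = z≤n
bit≤ w true  = ≤-refl

module Pattern (n′ : ℕ) where

  n : ℕ
  n = suc n′

  data Position : Set where
    position : (k : ℕ) (h : Bool) (m : Fin n) (b c : Bool) → Position

  value : Position → ℕ
  value (position k h m b c) = 8 * n * k + bit (4 * n) h + 4 * toℕ m + (bit 2 b + bit 1 c)

  label : Position → ℕ
  label (position k h m b c) = bit 2 h + bit 1 b

  data Removes (s : ℕ) (d : Position) : Maybe Position → Set where
    illegal : value d < s → Removes s d nothing
    legal   : ∀ {e} → s + value e ≡ value d → Removes s d (just e)

  removes-trans : ∀ {s t d r} {f : Position → Maybe Position} →
    Removes s d r → (∀ e → Removes t e (f e)) → Removes (t + s) d (r >>= f)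
  removes-trans {s} {t} (illegal d<s) _ = illegal (<-≤-trans d<s (m≤n+m s t))
  removes-trans {s} {t} {d} {just e} {f} (legal s+e≡d) removes-t with f e | removes-t e
  ... | nothing | illegal e<t = illegal (begin-strict
    value d      ≡⟨ sym s+e≡d ⟩
    s + value e  <⟨ +-monoʳ-< s e<t ⟩
    s + t        ≡⟨ +-comm s t ⟩
    t + s        ∎)
    where open ≤-Reasoning
  ... | just e′ | legal t+e′≡e = legal (begin
    t + s + value e′    ≡⟨ cong (_+ value e′) (+-comm t s) ⟩
    s + t + value e′    ≡⟨ +-assoc s t (value e′) ⟩
    s + (t + value e′)  ≡⟨ cong (s +_) t+e′≡e ⟩
    s + value e         ≡⟨ s+e≡d ⟩
    value d             ∎)
    where open ≡-Reasoning

  remove2 : Position → Maybe Position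
  remove2 (position k       h     m       true  c) = just (position k h m false c)
  remove2 (position k       h     (suc m) false c) = just (position k h (inject₁ m) true c)
  remove2 (position k       true  zero    false c) = just (position k false (fromℕ n′) true c)
  remove2 (position (suc k) false zero    false c) = just (position k true (fromℕ n′) true c)
  remove2 (position zero    false zero    false c) = nothing

  remove4n : Position → Maybe Position
  remove4n (position k       true  m b c) = just (position k false m b c)
  remove4n (position (suc k) false m b c) = just (position k true m b c)
  remove4n (position zero    false m b c) = nothing

  remove4n+2 : Position → Maybe Position
  remove4n+2 d = remove2 d >>= remove4n

  remove2-correct : ∀ d → Removes 2 d (remove2 d)
  remove2-correct (position k h m true c) =
    legal (x∙yz≈y∙xz 2 (8 * n * k + bit (4 * n) h + 4 * toℕ m) (bit 1 c))
  remove2-correct (position k h (suc m) false c) = legal eq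
    where
    borrow : ∀ A M C → 2 + (A + 4 * M + (2 + C)) ≡ A + 4 * suc M + C
    borrow = solve-∀
    eq : 2 + value (position k h (inject₁ m) true c) ≡ value (position k h (suc m) false c)
    eq rewrite toℕ-inject₁ m = borrow (8 * n * k + bit (4 * n) h) (toℕ m) (bit 1 c)
  remove2-correct (position k true zero false c) = legal eq
    where
    borrow : ∀ K p C → 2 + (K + 0 + 4 * p + (2 + C)) ≡ K + 4 * suc p + 0 + C
    borrow = solve-∀
    eq : 2 + value (position k false (fromℕ n′) true c) ≡ value (position k true zero false c)
    eq rewrite toℕ-fromℕ n′ = borrow (8 * n * k) n′ (bit 1 c)
  remove2-correct (position (suc k) false zero false c) = legal eq
    where
    borrow : ∀ k p C →
      2 + (8 * suc p * k + 4 * suc p + 4 * p + (2 + C)) ≡ 8 * suc p * suc k + 0 + 0 + C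
    borrow = solve-∀
    eq : 2 + value (position k true (fromℕ n′) true c)
       ≡ value (position (suc k) false zero false c)
    eq rewrite toℕ-fromℕ n′ = borrow k n′ (bit 1 c)
  remove2-correct (position zero false zero false c) = illegal bound
    where
    bound : value (position zero false zero false c) < 2
    bound rewrite *-zeroʳ (8 * n) = s≤s (bit≤ 1 c)

  offset<4n : ∀ (m : Fin n) b c → 4 * toℕ m + (bit 2 b + bit 1 c) < 4 * n
  offset<4n m b c = begin-strict
    4 * toℕ m + (bit 2 b + bit 1 c)  <⟨ +-monoʳ-< (4 * toℕ m) bits<4 ⟩
    4 * toℕ m + 4                    ≡⟨ +-comm (4 * toℕ m) 4 ⟩
    4 + 4 * toℕ m                    ≡⟨ sym (*-suc 4 (toℕ m)) ⟩
    4 * suc (toℕ m)                  ≤⟨ *-monoʳ-≤ 4 (toℕ<n m) ⟩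
    4 * n                            ∎
    where
    open ≤-Reasoning
    bits<4 : bit 2 b + bit 1 c < 4
    bits<4 = s≤s (+-mono-≤ (bit≤ 2 b) (bit≤ 1 c))

  remove4n-correct : ∀ d → Removes (4 * n) d (remove4n d)
  remove4n-correct (position k true m b c) =
    legal (shift (4 * n) (8 * n * k) (4 * toℕ m) (bit 2 b + bit 1 c))
    where
    shift : ∀ N K R T → N + (K + 0 + R + T) ≡ K + N + R + T
    shift = solve-∀
  remove4n-correct (position (suc k) false m b c) =
    legal (carry n′ k (4 * toℕ m) (bit 2 b + bit 1 c))
    where
    carry : ∀ p k R T →
      4 * suc p + (8 * suc p * k + 4 * suc p + R + T) ≡ 8 * suc p * suc k + 0 + R + T
    carry = solve-∀
  remove4n-correct (position zero false m b c) = illegal bound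
    where
    bound : value (position zero false m b c) < 4 * n
    bound rewrite *-zeroʳ (8 * n) = offset<4n m b c

  remove4n+2-correct : ∀ d → Removes (4 * n + 2) d (remove4n+2 d)
  remove4n+2-correct d = removes-trans (remove2-correct d) remove4n-correct

  optionLabels : Position → List ℕ
  optionLabels d = Maybe.map label (remove2 d) ?∷ Maybe.map label (remove4n d)
                ?∷ Maybe.map label (remove4n+2 d) ?∷ []

  mex-optionLabels : ∀ d → mex (optionLabels d) ≡ label d
  mex-optionLabels (position k       true  m       true  c) = refl
  mex-optionLabels (position zero    false m       true  c) = refl
  mex-optionLabels (position (suc k) false m       true  c) = refl
  mex-optionLabels (position k       true  (suc m) false c) = refl
  mex-optionLabels (position zero    false (suc m) false c) = refl
  mex-optionLabels (position (suc k) false (suc m) false c) = refl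
  mex-optionLabels (position zero    true  zero    false c) = refl
  mex-optionLabels (position (suc k) true  zero    false c) = refl
  mex-optionLabels (position zero    false zero    false c) = refl
  mex-optionLabels (position (suc k) false zero    false c) = refl

  GrundyIsLabel : Position → Set
  GrundyIsLabel d = grundy n (value d) ≡ label d

  removes-smaller : ∀ {s d r} → Removes (suc s) d r → AllMaybe (λ e → value e < value d) r
  removes-smaller (illegal _) = nothing
  removes-smaller {s} (legal {e} s+e≡d) =
    just (subst (value e <_) s+e≡d (m<n+m (value e) (z<s {s})))

  optVals-removes : ∀ {d s r} ss → Removes (suc s) d r → AllMaybe GrundyIsLabel r →
    optVals (history n (value d)) (value d) (suc s ∷ ss)
      ≡ Maybe.map label r ?∷ optVals (history n (value d)) (value d) ss
  optVals-removes ss (illegal d<s) nothing = optVals-illegal ss d<s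
  optVals-removes {d} ss (legal s+e≡d) (just grundy≡label) =
    trans (optVals-legal n ss s+e≡d)
          (cong (_∷ optVals (history n (value d)) (value d) ss) grundy≡label)

  optVals-optionLabels : ∀ d → WfRec (_<_ on value) GrundyIsLabel d →
    optVals (history n (value d)) (value d) (moves n) ≡ optionLabels d
  optVals-optionLabels d ih = begin
    optVals H x (2 ∷ 4 * n ∷ 4 * n + 2 ∷ [])
      ≡⟨ contributes (4 * n ∷ 4 * n + 2 ∷ []) (remove2-correct d) ⟩
    ℓ₁ ?∷ optVals H x (4 * n ∷ 4 * n + 2 ∷ [])
      ≡⟨ cong (ℓ₁ ?∷_) (contributes (4 * n + 2 ∷ []) (remove4n-correct d)) ⟩
    ℓ₁ ?∷ ℓ₂ ?∷ optVals H x (4 * n + 2 ∷ [])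
      ≡⟨ cong (λ l → ℓ₁ ?∷ ℓ₂ ?∷ l) (contributes [] (remove4n+2-correct d)) ⟩
    optionLabels d
      ∎
    where
    open ≡-Reasoning
    x : ℕ
    x = value d
    H : List ℕ
    H = history n x
    ℓ₁ ℓ₂ : Maybe ℕ
    ℓ₁ = Maybe.map label (remove2 d)
    ℓ₂ = Maybe.map label (remove4n d)
    contributes : ∀ {s r} ss → Removes (suc s) d r →
      optVals H x (suc s ∷ ss) ≡ Maybe.map label r ?∷ optVals H x ss
    -- ih is eta-expanded because value is not injective, so e cannot be inferred.
    contributes ss removes =
      optVals-removes ss removes (AllMaybe.map (λ {e} → ih {e}) (removes-smaller removes))

  grundy-position : ∀ d → GrundyIsLabel d
  grundy-position = All.wfRec (On.wellFounded value <-wellFounded) _ _ λ d ih → begin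
    grundy n (value d)    ≡⟨ cong mex (optVals-optionLabels d (λ {e} → ih {e})) ⟩
    mex (optionLabels d)  ≡⟨ mex-optionLabels d ⟩
    label d               ∎
    where open ≡-Reasoning

  grundy-pattern : ∀ k h {m} → m < n → ∀ b c →
    grundy n (8 * n * k + bit (4 * n) h + 4 * m + (bit 2 b + bit 1 c)) ≡ bit 2 h + bit 1 b
  grundy-pattern k h {m} m<n b c =
    subst (λ i → grundy n (8 * n * k + bit (4 * n) h + 4 * i + (bit 2 b + bit 1 c))
                   ≡ bit 2 h + bit 1 b)
      (toℕ-fromℕ< m<n) (grundy-position (position k h (fromℕ< m<n) b c))

theorem10 : (n : ℕ) → 1 ≤ n → (k m : ℕ) → m ≤ n ∸ 1 →
    ((grundy n (8 * n * k + 4 * m + 0) ≡ 0) × (grundy n (8 * n * k + 4 * m + 1) ≡ 0))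
    × ((grundy n (8 * n * k + 4 * m + 2) ≡ 1) × (grundy n (8 * n * k + 4 * m + 3) ≡ 1))
    × ((grundy n (8 * n * k + 4 * n + 4 * m + 0) ≡ 2) × (grundy n (8 * n * k + 4 * n + 4 * m + 1) ≡ 2))
    × ((grundy n (8 * n * k + 4 * n + 4 * m + 2) ≡ 3) × (grundy n (8 * n * k + 4 * n + 4 * m + 3) ≡ 3))
theorem10 (suc n′) (s≤s z≤n) k m m≤n′ =
  (lower false false , lower false true) , (lower true false , lower true true) ,
  (upper false false , upper false true) , (upper true false , upper true true)
  where
  open Pattern n′
  lower : ∀ b c → grundy n (8 * n * k + 4 * m + (bit 2 b + bit 1 c)) ≡ bit 1 b
  lower b c = subst (λ j → grundy n (j + 4 * m + (bit 2 b + bit 1 c)) ≡ bit 1 b)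
    (+-identityʳ (8 * n * k)) (grundy-pattern k false (s≤s m≤n′) b c)
  upper : ∀ b c → grundy n (8 * n * k + 4 * n + 4 * m + (bit 2 b + bit 1 c)) ≡ 2 + bit 1 b
  upper = grundy-pattern k true (s≤s m≤n′)
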